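{- Let $\alpha,q\ge1$ and $i,j\in\{1,\dots,q\}$. Each of the formulas $\mathrm{reach}^+(x_i,x_j)$, $\mathrm{emp}$ and $\mathrm{size}\ge\beta$ (with $\beta\le\alpha$) is logically equivalent (i.e. satisfied by exactly the same memory states) to a Boolean combination of test formulas from $\mathrm{Test}(q,\alpha)$.
   Context: A memory state is $(s,h)$ with $s:\mathrm{PVAR}\to\mathrm{LOC}$ (program variables $x_1,x_2,\dots$) and $h$ a partial function $\mathrm{LOC}\to\mathrm{LOC}$ with finite domain. $h^0=\mathrm{id}$, $h^{n+1}(l)=h(h^n(l))$ when defined. Semantics: $(s,h)\models\mathrm{emp}$ iff $\mathrm{dom}(h)=\emptyset$; $(s,h)\models\mathrm{size}\ge\beta$ iff $|\mathrm{dom}(h)|\ge\beta$; $(s,h)\models\mathrm{reach}^+(x,y)$ iff there is $i\ge1$ with $h^i(s(x))=s(y)$. Terms: $\mathrm{Terms}_q=\{x_1,\dots,x_q\}\cup\{m_q(x_i,x_j)\mid i,j\in\{1,\dots,q\}\}$. $[\![x_i]\!]^q_{s,h}=s(x_i)$; $[\![m_q(x_i,x_j)]\!]^q_{s,h}$ is the unique location $l$ (undefined if none) such that there are $L_1,L_2\ge0$ with $h^{L_1}(s(x_i))=h^{L_2}(s(x_j))=l$, for all $L_1'<L_1$ and $L_2'\ge0$, $h^{L_1'}(s(x_i))\neq h^{L_2'}(s(x_j))$, and there are $k\le q$, $L\ge0$ with $h^L(l)=s(x_k)$. $\mathrm{Labels}_q(s,h)$ is the set of defined values $[\![t]\!]^q_{s,h}$,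 $t\in\mathrm{Terms}_q$. Support graph $(V,E,A,\mathrm{Lab},\mathrm{Btw},\mathrm{Rem})$ of $(s,h)$: $V=\mathrm{Labels}_q(s,h)$; $(l,l')\in E$ iff $l,l'\in V$, there is $L\ge1$ with $h^L(l)=l'$ and $h^{L'}(l)\notin V$ for all $0<L'<L$; $A=V\cap\mathrm{dom}(h)$; $\mathrm{Lab}(l)=\{t\in\mathrm{Terms}_q\mid[\![t]\!]^q_{s,h}=l\}$; for $(l,l')\in E$, $\mathrm{Btw}(l,l')$ is the set of $l''$ such that there are $L,L'\ge1$ with $h^L(l)=l''$, $h^{L'}(l'')=l'$ and $h^{L''}(l)\notin V$ for all $L''\in[1,L]$; $\mathrm{Rem}=\mathrm{dom}(h)\setminus(A\cup\bigcup_{(l,l')\in E}\mathrm{Btw}(l,l'))$. $\mathrm{Test}(q,\alpha)$ consists of the formulas $t=t'$, $\mathrm{alloc}(t)$, $t\hookrightarrow t'$, $\mathrm{sees}_q(t,t')\ge\beta+1$, $\mathrm{sizeR}_q\ge\beta$ for $t,t'\in\mathrm{Terms}_q$, $\beta\in\{1,\dots,\alpha\}$, with semantics: $t=t'$ iff some $l\in V$ has $\{t,t'\}\subseteq\mathrm{Lab}(l)$; $\mathrm{alloc}(t)$ iff some $l\in A$ has $t\in\mathrm{Lab}(l)$; $t\hookrightarrow t'$ iff some $(l,l')\in E$ has $t\in\mathrm{Lab}(l)$, $t'\in\mathrm{Lab}(l')$, $|\mathrm{Btw}(l,l')|=0$; $\mathrm{sees}_q(t,t')\ge\beta+1$ iff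 some $(l,l')\in E$ has $t\in\mathrm{Lab}(l)$, $t'\in\mathrm{Lab}(l')$, $|\mathrm{Btw}(l,l')|\ge\beta$; $\mathrm{sizeR}_q\ge\beta$ iff $|\mathrm{Rem}|\ge\beta$. -}

module Defs where

open import Data.Nat using (ℕ; zero; suc; _≤_; _<_)
open import Data.Fin using (Fin; toℕ)
open import Data.Maybe using (Maybe; just; nothing; _>>=_)
open import Data.Product using (Σ; ∃; ∃-syntax; _×_; _,_)
open import Data.Sum using (_⊎_)
open import Relation.Nullary using (¬_)
open import Relation.Binary.PropositionalEquality using (_≡_; _≢_)
open import Function.Definitions using (Injective)
open import Function.Bundles using (_⇔_)

LOC : Set
LOC = ℕ

-- Stores: PVAR → LOC, program variable x_{k+1} is index k.
Store : Set
Store = ℕ → LOC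

record Heap : Set where
  field
    fun    : LOC → Maybe LOC
    finite : ∃[ N ] (∀ l → N ≤ l → fun l ≡ nothing)
open Heap public

InDom : Heap → LOC → Set
InDom h l = ∃[ v ] (fun h l ≡ just v)

hpow : Heap → ℕ → LOC → Maybe LOC
hpow h zero    l = just l
hpow h (suc n) l = hpow h n l >>= fun h

AtLeast : ℕ → (LOC → Set) → Set
AtLeast n P = Σ (Fin n → LOC) λ f → Injective _≡_ _≡_ f × (∀ k → P (f k))

var : Store → {q : ℕ} → Fin q → LOC
var s i = s (toℕ i)

_⊨reach⁺_,_ : Store × Heap → ℕ → ℕ → Set
(s , h) ⊨reach⁺ x , y = ∃[ i ] (1 ≤ i × hpow h i (s x) ≡ just (s y))

_⊨emp : Store × Heap → Set
(s , h) ⊨emp = ∀ l → ¬ InDom h l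

_⊨size≥_ : Store × Heap → ℕ → Set
(s , h) ⊨size≥ β = AtLeast β (InDom h)

data Term (q : ℕ) : Set where
  x : Fin q → Term q
  m : Fin q → Fin q → Term q

MeetCond : {q : ℕ} → Store → Heap → Fin q → Fin q → LOC → Set
MeetCond {q} s h i j l =
  (∃[ L₁ ] ∃[ L₂ ] (hpow h L₁ (var s i) ≡ just l × hpow h L₂ (var s j) ≡ just l ×
     (∀ L₁' → L₁' < L₁ → ∀ L₂' l' → hpow h L₂' (var s j) ≡ just l' →
        hpow h L₁' (var s i) ≢ just l')))
  × (∃[ k ] ∃[ L ] (hpow h L l ≡ just (var s {q} k)))

-- ⟦t⟧^q_{s,h} = l  (undefined if no such location)
Den : {q : ℕ} → Store → Heap → Term q → LOC → Set
Den     s h (x i)   l = l ≡ var s i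
Den s h (m i j) l = MeetCond s h i j l × (∀ l' → MeetCond s h i j l' → l' ≡ l)

module Support {q : ℕ} (s : Store) (h : Heap) where

  V : LOC → Set
  V l = ∃[ t ] Den {q} s h t l

  E : LOC → LOC → Set
  E l l' = V l × V l' × ∃[ L ] (1 ≤ L × hpow h L l ≡ just l' ×
             (∀ L' z → 0 < L' → L' < L → hpow h L' l ≡ just z → ¬ V z))

  A : LOC → Set
  A l = V l × InDom h l

  Lab : LOC → Term q → Set
  Lab l t = Den s h t l

  Btw : LOC → LOC → LOC → Set
  Btw l l' l'' = ∃[ L ] ∃[ L' ] (1 ≤ L × 1 ≤ L' × hpow h L l ≡ just l'' ×
                   hpow h L' l'' ≡ just l' ×
                   (∀ L'' z → 1 ≤ L'' → L'' ≤ L → hpow h L'' l ≡ just z → ¬ V z))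

  Rem : LOC → Set
  Rem z = InDom h z × ¬ A z × ¬ (∃[ l ] ∃[ l' ] (E l l' × Btw l l' z))

data Test (q α : ℕ) : Set where
  eq    : Term q → Term q → Test q α
  alloc : Term q → Test q α
  pts   : Term q → Term q → Test q α
  sees  : Term q → Term q → (β : ℕ) → 1 ≤ β → β ≤ α → Test q α   -- sees_q(t,t') ≥ β+1
  sizeR : (β : ℕ) → 1 ≤ β → β ≤ α → Test q α

⟦_⟧T : {q α : ℕ} → Test q α → Store × Heap → Set
⟦_⟧T {q} (eq t t') (s , h) = ∃[ l ] (V l × Lab l t × Lab l t')
  where open Support {q} s h
⟦_⟧T {q} (alloc t) (s , h) = ∃[ l ] (A l × Lab l t)
  where open Support {q} s h
⟦_⟧T {q} (pts t t') (s , h) =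
  ∃[ l ] ∃[ l' ] (E l l' × Lab l t × Lab l' t' × (∀ z → ¬ Btw l l' z))
  where open Support {q} s h
⟦_⟧T {q} (sees t t' β _ _) (s , h) =
  ∃[ l ] ∃[ l' ] (E l l' × Lab l t × Lab l' t' × AtLeast β (Btw l l'))
  where open Support {q} s h
⟦_⟧T {q} (sizeR β _ _) (s , h) = AtLeast β Rem
  where open Support {q} s h

data BoolComb (At : Set) : Set where
  atom : At → BoolComb At
  ¬'_  : BoolComb At → BoolComb At
  _∧'_ : BoolComb At → BoolComb At → BoolComb At
  _∨'_ : BoolComb At → BoolComb At → BoolComb At

⟦_⟧B : {q α : ℕ} → BoolComb (Test q α) → Store × Heap → Set
⟦ atom a ⟧B σ = ⟦ a ⟧T σ
⟦ ¬' φ ⟧B σ = ¬ ⟦ φ ⟧B σ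
⟦ φ ∧' ψ ⟧B σ = ⟦ φ ⟧B σ × ⟦ ψ ⟧B σ
⟦ φ ∨' ψ ⟧B σ = ⟦ φ ⟧B σ ⊎ ⟦ ψ ⟧B σ

EquivBC : (q α : ℕ) → (Store × Heap → Set) → Set
EquivBC q α P = ∃[ φ ] (∀ σ → P σ ⇔ ⟦_⟧B {q} {α} φ σ)

-- Everything is read off the support graph of (s, h).
--
-- A heap path from x_i to x_j visits labelled locations, so reach⁺(x_i, x_j) holds iff the
-- support graph has a walk from x_i to x_j.  Cutting out repeated terms, walks with fewer
-- than |Terms_q| edges suffice, and every edge is a test t ↪ t' or sees_q(t, t') ≥ 2.
--
-- The domain of h is the disjoint union of Rem and of the segments {l} ∪ Btw(l, l') of the
-- allocated labelled l, where l' is the successor of l in the support graph (Btw is empty if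
-- there is none).  Disjointness is the heart of the matter: follow the paths
-- from two labelled sources l₁, l₂ backwards from a common location z.  Either one runs into
-- the other's source, which is labelled, or they first separate at a location with two
-- different predecessors; the program variables entering it through these predecessors meet
-- exactly there, so it is a meet point m_q(x_u, x_w) and thus labelled, a contradiction.
-- Counting up to α in each segment and in Rem is done by alloc, sees and sizeR, which gives
-- size ≥ β; emp is ¬ size ≥ 1.
--
-- The case analyses are classical; they are run under a double negation, which is removed at
-- the end because size ≥ β and reach⁺ are decidable for a finite heap.

module Submission where

open import Defs
open import Level using (0ℓ)
open import Data.Bool using (if_then_else_)
open import Data.Empty using (⊥-elim)
open import Data.Nat using (ℕ; zero; suc; _+_; _∸_; _*_; _⊓_; _≤_; _<_; z≤n; s≤s; s≤s⁻¹; z<s)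
open import Data.Nat using (_≟_; _<?_; _≤?_)
open import Data.Nat.Properties
open import Data.Nat.Induction using (<-rec)
import Data.Fin as Fin
open import Data.Fin using (Fin; toℕ; fromℕ<; splitAt; inject≤; _↑ˡ_; _↑ʳ_; combine; remQuot)
open import Data.Fin using () renaming (zero to fzero; suc to fsuc)
open import Data.Fin.Properties
  using ( splitAt-↑ˡ; splitAt-↑ʳ; remQuot-combine; inject≤-injective; toℕ<n; toℕ-fromℕ<
        ; pigeonhole; any?)
  renaming (suc-injective to fsuc-injective; 0≢1+n to fzero≢fsuc)
open import Data.List as List using (List; []; _∷_; allFin; upTo)
open import Data.List.Relation.Unary.Any using (here; there)
open import Data.List.Membership.Propositional using (_∈_)
open import Data.List.Membership.Propositional.Properties using (∈-map⁺; ∈-allFin; ∈-upTo⁺; ∈-upTo⁻)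
open import Data.Maybe as Maybe using (just; nothing)
open import Data.Maybe.Properties as Maybe using (just-injective)
open import Data.Product as Product using (Σ; ∃₂; ∃-syntax; _×_; _,_; proj₁; proj₂; uncurry)
open import Data.Sum as Sum using (_⊎_; inj₁; inj₂; [_,_]′)
open import Effect.Monad using (RawMonad)
open import Function.Base using (_∘_)
open import Function.Bundles using (_⇔_; mk⇔; Equivalence)
open import Function.Definitions using (Injective)
open import Relation.Binary.Definitions using (tri<; tri≈; tri>)
open import Relation.Binary.PropositionalEquality
open import Relation.Nullary using (¬_; Dec; yes; no; does; contradiction)
open import Relation.Nullary.Decidable using (¬¬-excluded-middle; map′; _×-dec_; decidable-stable)
open import Relation.Nullary.Negation using (¬¬-Monad)
open import Relation.Unary using (Pred; Decidable; _⊆_; _∪_; _∩_; _∖_; ｛_｝)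

open ≡-Reasoning
open RawMonad (¬¬-Monad {0ℓ}) using (_>>=_; pure)

-- Double negation and counting

Least : Pred ℕ 0ℓ → Pred ℕ 0ℓ
Least P k = P k × ∀ j → j < k → ¬ P j

¬¬-least : (P : Pred ℕ 0ℓ) {n : ℕ} → P n → ¬ ¬ (∃[ k ] (k ≤ n × Least P k))
¬¬-least P {n} = <-rec (λ n → P n → ¬ ¬ (∃[ k ] (k ≤ n × Least P k))) least n
  where
  least : ∀ n → (∀ {j} → j < n → P j → ¬ ¬ (∃[ k ] (k ≤ j × Least P k))) →
          P n → ¬ ¬ (∃[ k ] (k ≤ n × Least P k))
  least n below Pn = do
    no nothing-below ← ¬¬-excluded-middle {A = ∃[ j ] (j < n × P j)}
      where yes (j , j<n , Pj) → do
              (k , k≤j , least-k) ← below j<n Pj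
              pure (k , ≤-trans k≤j (<⇒≤ j<n) , least-k)
    pure (n , ≤-refl , Pn , λ j j<n Pj → nothing-below (j , j<n , Pj))

¬¬-∀-Fin : ∀ {n} (R : Fin n → Set) → (∀ i → ¬ ¬ R i) → ¬ ¬ (∀ i → R i)
¬¬-∀-Fin {zero}  R r = pure λ ()
¬¬-∀-Fin {suc n} R r = do
  r₀ ← r fzero
  rₛ ← ¬¬-∀-Fin (λ i → R (fsuc i)) (λ i → r (fsuc i))
  pure λ { fzero → r₀ ; (fsuc i) → rₛ i }

private variable
  P Q : Pred LOC 0ℓ
  n : ℕ
  y : LOC

AtLeast-mono : P ⊆ Q → AtLeast n P → AtLeast n Q
AtLeast-mono P⊆Q (f , f-inj , f∈P) = f , f-inj , λ i → P⊆Q (f∈P i)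

AtLeast-¬¬ : (∀ {z} → P z → ¬ ¬ Q z) → AtLeast n P → ¬ ¬ AtLeast n Q
AtLeast-¬¬ P⇒¬¬Q (f , f-inj , f∈P) = do
  f∈Q ← ¬¬-∀-Fin _ (λ i → P⇒¬¬Q (f∈P i))
  pure (f , (λ {i} {j} → f-inj {i} {j}) , f∈Q)

AtLeast-0 : AtLeast 0 P
AtLeast-0 = (λ ()) , (λ { {()} }) , (λ ())

AtLeast-cons : P y → AtLeast n (P ∖ ｛ y ｝) → AtLeast (suc n) P
AtLeast-cons {P = P} {y = y} Py (f , f-inj , f∈P∖y) = g , g-inj , g∈P
  where
  g : Fin _ → LOC
  g fzero    = y
  g (fsuc i) = f i
  g-inj : Injective _≡_ _≡_ g
  g-inj {fzero}  {fzero}  _  = refl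
  g-inj {fzero}  {fsuc j} same = ⊥-elim (proj₂ (f∈P∖y j) same)
  g-inj {fsuc i} {fzero}  same = ⊥-elim (proj₂ (f∈P∖y i) (sym same))
  g-inj {fsuc i} {fsuc j} same = cong fsuc (f-inj same)
  g∈P : ∀ i → P (g i)
  g∈P fzero    = Py
  g∈P (fsuc i) = proj₁ (f∈P∖y i)

AtLeast-uncons : AtLeast (suc n) P → ∃[ y ] (P y × AtLeast n (P ∖ ｛ y ｝))
AtLeast-uncons (f , f-inj , f∈P) =
  f fzero , f∈P fzero ,
  (λ i → f (fsuc i)) , (λ same → fsuc-injective (f-inj same)) ,
  λ i → f∈P (fsuc i) , λ same → fzero≢fsuc (f-inj same)

AtLeast-1 : P y → AtLeast 1 P
AtLeast-1 {P = P} {y = y} Py = AtLeast-cons Py (AtLeast-0 {P = P ∖ ｛ y ｝})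

AtLeast-weaken : ∀ {k n} → k ≤ n → AtLeast n P → AtLeast k P
AtLeast-weaken k≤n (f , f-inj , f∈P) =
  (λ i → f (inject≤ i k≤n)) , (λ same → inject≤-injective k≤n k≤n _ _ (f-inj same)) , λ _ → f∈P _

AtLeast-subsingleton : P ⊆ ｛ y ｝ → AtLeast n P → n ≤ 1
AtLeast-subsingleton {n = zero}        _    _  = z≤n
AtLeast-subsingleton {n = suc zero}    _    _  = s≤s z≤n
AtLeast-subsingleton {P = P} {n = suc (suc n)} P⊆y at
  with z₁ , Pz₁ , at' ← AtLeast-uncons at
  with z₂ , (Pz₂ , z₁≢z₂) , _ ← AtLeast-uncons {P = P ∖ ｛ z₁ ｝} at'
  = contradiction (trans (sym (P⊆y Pz₁)) (P⊆y Pz₂)) z₁≢z₂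

AtLeast-empty : (∀ {z} → ¬ P z) → AtLeast n P → n ≡ 0
AtLeast-empty {n = zero}  _     _  = refl
AtLeast-empty {P = P} {n = suc n} empty at =
  contradiction (proj₁ (proj₂ (AtLeast-uncons {P = P} at))) empty

AtLeast-∪ : ∀ {a b} → (∀ {z} → P z → ¬ Q z) →
            AtLeast a P → AtLeast b Q → AtLeast (a + b) (P ∪ Q)
AtLeast-∪ {P = P} {Q = Q} {a = zero} disjoint _ atQ = AtLeast-mono {P = Q} {Q = P ∪ Q} inj₂ atQ
AtLeast-∪ {P = P} {Q = Q} {a = suc a} disjoint atP atQ
  with y , Py , atP∖y ← AtLeast-uncons {P = P} atP
  = AtLeast-cons {P = P ∪ Q} (inj₁ Py)
      (AtLeast-mono {P = (P ∖ ｛ y ｝) ∪ Q} drop-y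
        (AtLeast-∪ {P = P ∖ ｛ y ｝} (λ P∖y-z → disjoint (proj₁ P∖y-z)) atP∖y atQ))
  where
  drop-y : (P ∖ ｛ y ｝) ∪ Q ⊆ (P ∪ Q) ∖ ｛ y ｝
  drop-y (inj₁ (Pz , y≢z)) = inj₁ Pz , y≢z
  drop-y (inj₂ Qz)         = inj₂ Qz , λ { refl → disjoint Py Qz }

AtLeast-∪⁻ : ∀ k → AtLeast k (P ∪ Q) → ∃[ c ] (c ≤ k × AtLeast c P × AtLeast (k ∸ c) Q)
AtLeast-∪⁻ {P = P} {Q = Q} zero _ = 0 , z≤n , AtLeast-0 {P = P} , AtLeast-0 {P = Q}
AtLeast-∪⁻ {P = P} {Q = Q} (suc k) at
  with y , P∪Qy , rest ← AtLeast-uncons {P = P ∪ Q} at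
  with c , c≤k , atP , atQ ← AtLeast-∪⁻ {P = P ∖ ｛ y ｝} {Q = Q ∖ ｛ y ｝} k
         (AtLeast-mono {P = (P ∪ Q) ∖ ｛ y ｝}
           (λ { (P∪Qz , y≢z) → Sum.map (_, y≢z) (_, y≢z) P∪Qz }) rest)
  with P∪Qy
... | inj₁ Py = suc c , s≤s c≤k , AtLeast-cons Py atP , AtLeast-mono {P = Q ∖ ｛ y ｝} proj₁ atQ
... | inj₂ Qy = c , m≤n⇒m≤1+n c≤k , AtLeast-mono {P = P ∖ ｛ y ｝} proj₁ atP ,
                subst (λ n → AtLeast n Q) (sym (+-∸-assoc 1 c≤k)) (AtLeast-cons Qy atQ)

module Counting {P : Pred LOC 0ℓ} (P? : Decidable P) where

  count : ℕ → ℕ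
  count zero    = 0
  count (suc N) = (if does (P? N) then 1 else 0) + count N

  Below : ℕ → Pred LOC 0ℓ
  Below N z = P z × z < N

  private
    split-last : ∀ {N} → Below (suc N) ⊆ (P ∩ ｛ N ｝) ∪ Below N
    split-last (Pz , z<1+N) with m<1+n⇒m<n∨m≡n z<1+N
    ... | inj₁ z<N  = inj₂ (Pz , z<N)
    ... | inj₂ refl = inj₁ (Pz , refl)

  count-sound : ∀ N {k} → k ≤ count N → AtLeast k (Below N)
  count-sound zero {zero} _ = AtLeast-0 {P = Below 0}
  count-sound (suc N) {k} k≤ with P? N
  ... | no _ = AtLeast-mono {P = Below N} (Product.map₂ m≤n⇒m≤1+n) (count-sound N k≤)
  ... | yes PN with k ≤? count N
  ...   | yes k≤N = AtLeast-mono {P = Below N} (Product.map₂ m≤n⇒m≤1+n) (count-sound N k≤N)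
  ...   | no k≰N =
    subst (λ n → AtLeast n (Below (suc N))) (≤-antisym (≰⇒> k≰N) k≤)
      (AtLeast-mono {P = ｛ N ｝ ∪ Below N}
        (λ { (inj₁ refl) → PN , ≤-refl ; (inj₂ (Pz , z<N)) → Pz , m≤n⇒m≤1+n z<N })
        (AtLeast-∪ {P = ｛ N ｝} {Q = Below N} (λ { refl (_ , N<N) → <-irrefl refl N<N })
          (AtLeast-1 {P = ｛ N ｝} refl) (count-sound N ≤-refl)))

  count-complete : ∀ N {k} → AtLeast k (Below N) → k ≤ count N
  count-complete zero {zero} _ = z≤n
  count-complete zero {suc k} at with _ , (_ , ()) , _ ← AtLeast-uncons {P = Below 0} at
  count-complete (suc N) {k} at
    with c , c≤k , atLast , atRest ← AtLeast-∪⁻ {P = P ∩ ｛ N ｝} {Q = Below N} k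
                                       (AtLeast-mono {P = Below (suc N)} split-last at)
    = subst (_≤ count (suc N)) (m+[n∸m]≡n c≤k)
        (+-mono-≤ (last-bound (P? N)) (count-complete N atRest))
    where
    last-bound : (d : Dec (P N)) → c ≤ (if does d then 1 else 0)
    last-bound (yes _)  = AtLeast-subsingleton {P = P ∩ ｛ N ｝} proj₂ atLast
    last-bound (no ¬PN) =
      ≤-reflexive (AtLeast-empty {P = P ∩ ｛ N ｝} (λ { (PN , refl) → ¬PN PN }) atLast)

  AtLeast? : ∀ {N} → (∀ {z} → P z → z < N) → ∀ k → Dec (AtLeast k P)
  AtLeast? {N} bounded k =
    map′ (λ k≤ → AtLeast-mono {P = Below N} proj₁ (count-sound N k≤))
         (λ at → count-complete N (AtLeast-mono {P = P} (λ Pz → Pz , bounded Pz) at))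
         (k ≤? count N)

-- Iterating the heap

module Iteration (h : Heap) where

  -- A record rather than hpow h n l ≡ just y, so that l, n and y can be inferred.
  infix 4 _─[_]→_
  record _─[_]→_ (l : LOC) (n : ℕ) (y : LOC) : Set where
    constructor ⟨_⟩
    field ⌊_⌋ : hpow h n l ≡ just y
  open _─[_]→_ public

  private variable
    a b k : ℕ
    l v z c c₁ c₂ : LOC

  ─→-refl : l ─[ 0 ]→ l
  ─→-refl = ⟨ refl ⟩

  ─→-snoc : l ─[ n ]→ c → fun h c ≡ just z → l ─[ suc n ]→ z
  ─→-snoc ⟨ l→c ⟩ c↦z = ⟨ trans (cong (Maybe._>>= fun h) l→c) c↦z ⟩

  ─→-snoc⁻ : l ─[ suc n ]→ z → ∃[ c ] (l ─[ n ]→ c × fun h c ≡ just z)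
  ─→-snoc⁻ {l} {n} ⟨ l→z ⟩ with hpow h n l in l→c
  ... | just c = c , ⟨ l→c ⟩ , l→z

  ─→-deterministic : l ─[ n ]→ y → l ─[ n ]→ z → y ≡ z
  ─→-deterministic ⟨ l→y ⟩ ⟨ l→z ⟩ = just-injective (trans (sym l→y) l→z)

  ─→-continue : ∀ b → l ─[ a ]→ y → hpow h (b + a) l ≡ hpow h b y
  ─→-continue zero    ⟨ l→y ⟩ = l→y
  ─→-continue (suc b) l→y     = cong (Maybe._>>= fun h) (─→-continue b l→y)

  ─→-trans : l ─[ a ]→ y → y ─[ b ]→ z → l ─[ a + b ]→ z
  ─→-trans {l = l} {a = a} {b = b} l→y ⟨ y→z ⟩ =
    ⟨ trans (cong (λ n → hpow h n l) (+-comm a b)) (trans (─→-continue b l→y) y→z) ⟩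

  ─→-rest : a ≤ n → l ─[ a ]→ y → l ─[ n ]→ z → y ─[ n ∸ a ]→ z
  ─→-rest {a = a} {n = n} {l = l} a≤n l→y ⟨ l→z ⟩ =
    ⟨ trans (sym (─→-continue (n ∸ a) l→y)) (trans (cong (λ k → hpow h k l) (m∸n+n≡m a≤n)) l→z) ⟩

  ─→-prefix : k ≤ n → l ─[ n ]→ z → ∃[ y ] (l ─[ k ]→ y)
  ─→-prefix {k} {n} k≤n l→z with m≤n⇒m<n∨m≡n k≤n
  ... | inj₂ refl = _ , l→z
  ─→-prefix {k} {suc n} _ l→z | inj₁ k<1+n =
    ─→-prefix (s≤s⁻¹ k<1+n) (proj₁ (proj₂ (─→-snoc⁻ l→z)))

  ─→-split : l ─[ a + b ]→ z → ∃[ y ] (l ─[ a ]→ y × y ─[ b ]→ z)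
  ─→-split {a = a} {b = b} l→z with y , l→y ← ─→-prefix (m≤m+n a b) l→z =
    y , l→y , subst (λ k → _ ─[ k ]→ _) (m+n∸m≡n a b) (─→-rest (m≤m+n a b) l→y l→z)

  ─→-source-inDom : l ─[ suc n ]→ z → InDom h l
  ─→-source-inDom l→z with _ , ⟨ l↦y ⟩ , _ ← ─→-split {a = 1} l→z = _ , l↦y

  ─→-last-inDom : l ─[ suc n ]→ z → ∃[ c ] (l ─[ n ]→ c × InDom h c)
  ─→-last-inDom l→z with c , l→c , c↦z ← ─→-snoc⁻ l→z = c , l→c , _ , c↦z

  ─→-cycle : z ─[ a ]→ z → ∀ r → z ─[ r * a ]→ z
  ─→-cycle z→z zero    = ─→-refl
  ─→-cycle z→z (suc r) = ─→-trans z→z (─→-cycle z→z r)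

  FirstHit : LOC → ℕ → LOC → Set
  FirstHit l n z = l ─[ n ]→ z × ∀ j → j < n → ¬ l ─[ j ]→ z

  FirstHit-unique : FirstHit l a z → FirstHit l b z → a ≡ b
  FirstHit-unique {a = a} {b = b} (l→z , before-a) (l→z' , before-b) with <-cmp a b
  ... | tri< a<b _ _ = contradiction l→z (before-b a a<b)
  ... | tri≈ _ a≡b _ = a≡b
  ... | tri> _ _ b<a = contradiction l→z' (before-a b b<a)

  FirstHit-suffix : a ≤ n → l ─[ a ]→ v → FirstHit l n z → FirstHit v (n ∸ a) z
  FirstHit-suffix {a = a} a≤n l→v (l→z , before) =
    ─→-rest a≤n l→v l→z ,
    λ j j<n∸a v→z → before (a + j) (subst (a + j <_) (m+[n∸m]≡n a≤n) (+-monoʳ-< a j<n∸a))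
                                   (─→-trans l→v v→z)

  orbit-predecessor-unique : z ─[ a ]→ c₁ → fun h c₁ ≡ just z →
                             z ─[ b ]→ c₂ → fun h c₂ ≡ just z → c₁ ≡ c₂
  orbit-predecessor-unique {a = a} {b = b} = go (a + b) ≤-refl
    where
    fewer-steps : ∀ {i j fuel} → i < j → i + j ≤ suc fuel → i + (j ∸ suc i) ≤ fuel
    fewer-steps {i} {j} i<j i+j≤1+fuel =
      s≤s⁻¹ (<-≤-trans (+-monoʳ-< i (∸-monoʳ-< z<s i<j)) i+j≤1+fuel)
    go : ∀ {z c₁ c₂ a b} fuel → a + b ≤ fuel → z ─[ a ]→ c₁ → fun h c₁ ≡ just z →
         z ─[ b ]→ c₂ → fun h c₂ ≡ just z → c₁ ≡ c₂
    -- if a < b then z ─[ suc a ]→ z, so c₂ is already reached in b ∸ suc a steps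
    go {a = a} {b} fuel a+b≤fuel z→c₁ c₁↦z z→c₂ c₂↦z with <-cmp a b | fuel
    ... | tri≈ _ refl _ | _ = ─→-deterministic z→c₁ z→c₂
    ... | tri< a<b _ _ | zero = contradiction (≤-trans a<b (≤-trans (m≤n+m b a) a+b≤fuel)) λ ()
    ... | tri< a<b _ _ | suc fuel =
      go fuel (fewer-steps a<b a+b≤fuel) z→c₁ c₁↦z (─→-rest a<b (─→-snoc z→c₁ c₁↦z) z→c₂) c₂↦z
    ... | tri> _ _ b<a | zero = contradiction (≤-trans b<a (≤-trans (m≤m+n a b) a+b≤fuel)) λ ()
    ... | tri> _ _ b<a | suc fuel =
      go fuel (subst (_≤ fuel) (+-comm b _)
                (fewer-steps b<a (subst (_≤ suc fuel) (+-comm a b) a+b≤fuel)))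
         (─→-rest b<a (─→-snoc z→c₂ c₂↦z) z→c₁) c₁↦z z→c₂ c₂↦z

  InDom? : Decidable (InDom h)
  InDom? l with fun h l
  ... | just v  = yes (v , refl)
  ... | nothing = no λ ()

  dom-bound : ℕ
  dom-bound = proj₁ (finite h)

  InDom⇒<dom-bound : InDom h l → l < dom-bound
  InDom⇒<dom-bound {l} (v , l↦v) with dom-bound ≤? l
  ... | yes bound≤l = contradiction (trans (sym (proj₂ (finite h) l bound≤l)) l↦v) λ ()
  ... | no  bound≰l = ≰⇒> bound≰l

  AtLeast-InDom? : ∀ k → Dec (AtLeast k (InDom h))
  AtLeast-InDom? = Counting.AtLeast? InDom? InDom⇒<dom-bound

  Reach⁺ : LOC → LOC → Set
  Reach⁺ l y = ∃[ n ] (1 ≤ n × l ─[ n ]→ y)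

  Reach⁺-shorten : dom-bound < n → l ─[ n ]→ y → ∃[ n' ] (n' < n × 1 ≤ n' × l ─[ n' ]→ y)
  -- the first dom-bound + 1 locations on the path are allocated, so two of them coincide
  Reach⁺-shorten {n} {l} {y} dom-bound<n l→y = shortcut (pigeonhole (n<1+n dom-bound) slot)
    where
    p<n : ∀ (p : Fin (suc dom-bound)) → toℕ p < n
    p<n p = <-≤-trans (toℕ<n p) dom-bound<n
    visited : (p : Fin (suc dom-bound)) → ∃[ v ] (l ─[ toℕ p ]→ v × InDom h v)
    visited p = ─→-last-inDom (proj₂ (─→-prefix (p<n p) l→y))
    slot : Fin (suc dom-bound) → Fin dom-bound
    slot p = fromℕ< (InDom⇒<dom-bound (proj₂ (proj₂ (visited p))))
    same-location : ∀ {p p'} → slot p ≡ slot p' → proj₁ (visited p) ≡ proj₁ (visited p')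
    same-location same-slot =
      trans (sym (toℕ-fromℕ< _)) (trans (cong toℕ same-slot) (toℕ-fromℕ< _))
    shortcut : (∃₂ λ i j → i Fin.< j × slot i ≡ slot j) → ∃[ n' ] (n' < n × 1 ≤ n' × l ─[ n' ]→ y)
    shortcut (i , j , i<j , same-slot) =
      toℕ i + (n ∸ toℕ j) ,
      subst (toℕ i + (n ∸ toℕ j) <_) (m+[n∸m]≡n (<⇒≤ (p<n j))) (+-monoˡ-< (n ∸ toℕ j) i<j) ,
      ≤-trans (m<n⇒0<n∸m (p<n j)) (m≤n+m _ (toℕ i)) ,
      ─→-trans l→v (─→-rest (<⇒≤ (p<n j)) l→v' l→y)
      where
      l→v : l ─[ toℕ i ]→ proj₁ (visited j)
      l→v = subst (l ─[ toℕ i ]→_) (same-location {i} {j} same-slot) (proj₁ (proj₂ (visited i)))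
      l→v' : l ─[ toℕ j ]→ proj₁ (visited j)
      l→v' = proj₁ (proj₂ (visited j))

  Reach⁺-bounded : Reach⁺ l y → ∃[ n ] (n ≤ dom-bound × 1 ≤ n × l ─[ n ]→ y)
  Reach⁺-bounded {l} {y} (n , 1≤n , l→y) = <-rec Goal step n 1≤n l→y
    where
    Goal : ℕ → Set
    Goal n = 1 ≤ n → l ─[ n ]→ y → ∃[ n ] (n ≤ dom-bound × 1 ≤ n × l ─[ n ]→ y)
    step : ∀ n → (∀ {n'} → n' < n → Goal n') → Goal n
    step n shorter 1≤n l→y with n ≤? dom-bound
    ... | yes n≤ = n , n≤ , 1≤n , l→y
    ... | no  n≰ with n' , n'<n , 1≤n' , l→y' ← Reach⁺-shorten (≰⇒> n≰) l→y = shorter n'<n 1≤n' l→y'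

  Reach⁺? : ∀ l y → Dec (Reach⁺ l y)
  Reach⁺? l y = map′ (λ (p , 1≤p , l→y) → toℕ p , 1≤p , l→y) bounded (any? step?)
    where
    step? : ∀ (p : Fin (suc dom-bound)) → Dec (1 ≤ toℕ p × l ─[ toℕ p ]→ y)
    step? p = (1 ≤? toℕ p) ×-dec map′ ⟨_⟩ ⌊_⌋ (Maybe.≡-dec _≟_ (hpow h (toℕ p) l) (just y))
    bounded : Reach⁺ l y → ∃[ p ] (1 ≤ toℕ p × l ─[ toℕ p ]→ y)
    bounded r with n , n≤ , 1≤n , l→y ← Reach⁺-bounded r =
      fromℕ< (s≤s n≤) , subst (λ k → 1 ≤ k × l ─[ k ]→ y) (sym (toℕ-fromℕ< (s≤s n≤))) (1≤n , l→y)

-- The support graph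

module SupportGraph {q : ℕ} (s : Store) (h : Heap) where
  open Iteration h
  open Support {q} s h public

  private variable
    i j u v w : Fin q
    t : Term q
    K L : ℕ
    l l' l₁ l₂ l₁' l₂' p z c₁ c₂ : LOC

  ReachesVar : Pred LOC 0ℓ
  ReachesVar l = ∃[ k ] ∃[ n ] (hpow h n l ≡ just (var s {q} k))

  ReachesVar-back : l ─[ n ]→ z → ReachesVar z → ReachesVar l
  ReachesVar-back {n = n} l→z (k , L , z→k) = k , n + L , ⌊ ─→-trans l→z (⟨_⟩ {n = L} z→k) ⌋

  var∈V : ∀ v → V (var s v)
  var∈V v = x v , refl

  V⇒reached : V l → ∃[ v ] ∃[ n ] (var s v ─[ n ]→ l)
  V⇒reached (x v , refl)                           = v , 0 , ─→-refl
  V⇒reached (m i j , ((L₁ , _ , i→l , _ , _) , _) , _) = i , L₁ , ⟨ i→l ⟩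

  V⇒ReachesVar : V l → ReachesVar l
  V⇒ReachesVar (x v , refl)           = v , 0 , refl
  V⇒ReachesVar (m i j , (_ , l→var) , _) = l→var

  meet-unique : MeetCond s h i j l → MeetCond s h i j l' → l ≡ l'
  meet-unique ((L₁ , L₂ , i→l , j→l , first) , _) ((L₁' , L₂' , i→l' , j→l' , first') , _)
    with <-cmp L₁ L₁'
  ... | tri< L₁<L₁' _ _ = contradiction i→l (first' L₁ L₁<L₁' L₂ _ j→l)
  ... | tri≈ _ refl _   = just-injective (trans (sym i→l) i→l')
  ... | tri> _ _ L₁'<L₁ = contradiction i→l' (first L₁' L₁'<L₁ L₂' _ j→l')

  Lab-functional : Lab l t → Lab l' t → l ≡ l'
  Lab-functional {t = x v}   refl       refl        = refl
  Lab-functional {t = m i j} (meet , _) (meet' , _) = meet-unique meet meet'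

  E-functional : E l l₁ → E l l₂ → l₁ ≡ l₂
  E-functional (_ , V₁ , L₁ , 1≤L₁ , l→₁ , clear₁) (_ , V₂ , L₂ , 1≤L₂ , l→₂ , clear₂)
    with <-cmp L₁ L₂
  ... | tri< L₁<L₂ _ _ = contradiction V₁ (clear₂ L₁ _ 1≤L₁ L₁<L₂ l→₁)
  ... | tri≈ _ refl _  = just-injective (trans (sym l→₁) l→₂)
  ... | tri> _ _ L₂<L₁ = contradiction V₂ (clear₁ L₂ _ 1≤L₂ L₂<L₁ l→₂)

  Btw⇒¬V : Btw l l' z → ¬ V z
  Btw⇒¬V (L , _ , 1≤L , _ , l→z , _ , clear) = clear L _ 1≤L ≤-refl l→z

  Btw⇒source-inDom : Btw l l' z → InDom h l
  Btw⇒source-inDom (suc L , _ , _ , _ , l→z , _) = ─→-source-inDom {n = L} ⟨ l→z ⟩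

  Btw⇒inDom : Btw l l' z → InDom h z
  Btw⇒inDom (_ , suc L' , _ , _ , _ , z→l' , _) = ─→-source-inDom {n = L'} ⟨ z→l' ⟩

  meet-exists : var s u ─[ K ]→ z → (∃[ N ] (var s w ─[ N ]→ z)) → ReachesVar z →
    ¬ ¬ (∃[ M ] ∃[ p ] ∃[ N ] (M ≤ K × var s u ─[ M ]→ p × var s w ─[ N ]→ p × Lab p (m u w)))
  meet-exists {u = u} {w = w} u→z (N₀ , w→z) z→var = do
    (M , M≤K , (p , u→p , N , w→p) , earlier) ← ¬¬-least OnBoth (_ , u→z , N₀ , w→z)
    let first : ∀ M' → M' < M → ∀ N' l' →
                hpow h N' (var s w) ≡ just l' → hpow h M' (var s u) ≢ just l'
        first M' M'<M N' l' w→l' u→l' = earlier M' M'<M (l' , ⟨ u→l' ⟩ , N' , ⟨ w→l' ⟩)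
        meet : MeetCond s h u w p
        meet = (M , N , ⌊ u→p ⌋ , ⌊ w→p ⌋ , first) , ReachesVar-back (─→-rest M≤K u→p u→z) z→var
    pure (M , p , N , M≤K , u→p , w→p , meet , λ _ meet' → meet-unique meet' meet)
    where
    OnBoth : Pred ℕ 0ℓ
    OnBoth M = ∃[ p ] (var s u ─[ M ]→ p × ∃[ N ] (var s w ─[ N ]→ p))

  FirstEntry : Fin q → LOC → LOC → Set
  FirstEntry v c z = ∃[ i ] (FirstHit (var s v) (suc i) z × var s v ─[ i ]→ c)

  FirstEntry⇒↦ : FirstEntry v c₁ z → fun h c₁ ≡ just z
  FirstEntry⇒↦ (i , (v→z , _) , v→c) with c , v→c' , c↦z ← ─→-snoc⁻ v→z =
    subst (λ c → fun h c ≡ just _) (─→-deterministic v→c' v→c) c↦z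

  entry-loops : ¬ V z → ReachesVar z → FirstEntry u c₁ z → FirstEntry w c₂ z → c₁ ≢ c₂ →
                ¬ ¬ (∃[ n ] (z ─[ n ]→ c₁))
  entry-loops {z = z} {u = u} {c₁ = c₁} {w = w} {c₂ = c₂}
              ¬Vz z→var (i₁ , hit₁ , u→c₁) (i₂ , hit₂ , w→c₂) c₁≢c₂ = do
    -- p = m(u, w) is not z, as z is unlabelled, so it lies before z on u's path; then either
    -- w passes z before p, or u and w reach z from p in the same number of steps
    (M , p , N , M≤ , u→p , w→p , meet) ← meet-exists (proj₁ hit₁) (suc i₂ , proj₁ hit₂) z→var
    pure (locate M≤ u→p w→p meet)
    where
    locate : ∀ {M N p} → M ≤ suc i₁ → var s u ─[ M ]→ p → var s w ─[ N ]→ p → Lab p (m u w) →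
             ∃[ n ] (z ─[ n ]→ c₁)
    locate {M} {N} {p} M≤ u→p w→p meet with m≤n⇒m<n∨m≡n M≤
    ... | inj₂ refl =
      contradiction (m u w , subst (λ l → Lab l (m u w)) (─→-deterministic u→p (proj₁ hit₁)) meet)
                    ¬Vz
    ... | inj₁ M<1+i₁ with <-cmp N (suc i₂)
    ...   | tri> _ _ i₂<N =
      _ , ─→-trans (─→-rest (<⇒≤ i₂<N) (proj₁ hit₂) w→p) (─→-rest (s≤s⁻¹ M<1+i₁) u→p u→c₁)
    ...   | tri≈ _ refl _ =
      contradiction (subst (var s u ─[ M ]→_) (─→-deterministic w→p (proj₁ hit₂)) u→p)
                    (proj₂ hit₁ M M<1+i₁)
    ...   | tri< N<1+i₂ _ _ = contradiction c₁≡c₂ c₁≢c₂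
      where
      M≤i₁ = s≤s⁻¹ M<1+i₁
      N≤i₂ = s≤s⁻¹ N<1+i₂
      same-steps : i₁ ∸ M ≡ i₂ ∸ N
      same-steps = suc-injective (begin
        suc (i₁ ∸ M) ≡⟨ +-∸-assoc 1 M≤i₁ ⟨
        suc i₁ ∸ M   ≡⟨ FirstHit-unique (FirstHit-suffix M≤ u→p hit₁)
                                        (FirstHit-suffix (<⇒≤ N<1+i₂) w→p hit₂) ⟩
        suc i₂ ∸ N   ≡⟨ +-∸-assoc 1 N≤i₂ ⟩
        suc (i₂ ∸ N) ∎)
      c₁≡c₂ : c₁ ≡ c₂
      c₁≡c₂ = ─→-deterministic (─→-rest M≤i₁ u→p u→c₁)
                (subst (λ k → p ─[ k ]→ c₂) (sym same-steps) (─→-rest N≤i₂ w→p w→c₂))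

  first-entries-agree : ¬ V z → ReachesVar z → FirstEntry u c₁ z → FirstEntry w c₂ z → c₁ ≡ c₂
  first-entries-agree {c₁ = c₁} {c₂ = c₂} ¬Vz z→var entry₁ entry₂ =
    decidable-stable (c₁ ≟ c₂) λ c₁≢c₂ → (do
      (_ , z→c₁) ← entry-loops ¬Vz z→var entry₁ entry₂ c₁≢c₂
      (_ , z→c₂) ← entry-loops ¬Vz z→var entry₂ entry₁ (c₁≢c₂ ∘ sym)
      pure (orbit-predecessor-unique z→c₁ (FirstEntry⇒↦ entry₁) z→c₂ (FirstEntry⇒↦ entry₂))) c₁≢c₂

  -- a variable reached from l lies on the cycle through z, and enters z through the
  -- predecessor of z on it
  FirstEntry-on-cycle : ∀ {g} → ¬ V z → V l → z ─[ g ]→ l → l ─[ L ]→ c₁ → fun h c₁ ≡ just z →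
                        ¬ ¬ (∃[ v ] FirstEntry v c₁ z)
  FirstEntry-on-cycle {z = z} {l = l} {L = L} {c₁ = c} {g = g} ¬Vz Vl z→l l→c c↦z
    with k , Lₖ , l→k ← V⇒ReachesVar Vl = do
      (j , _ , k→z , before) ← ¬¬-least (λ j → var s k ─[ j ]→ z) k→z
      entry j k→z before
    where
    z→k : z ─[ g + Lₖ ]→ var s k
    z→k = ─→-trans z→l ⟨ l→k ⟩
    cycle : z ─[ suc (g + L) ]→ z
    cycle = subst (z ─[_]→ z) (+-suc g L) (─→-trans z→l (─→-snoc l→c c↦z))
    k→z : var s k ─[ (g + Lₖ) * suc (g + L) ∸ (g + Lₖ) ]→ z
    k→z = ─→-rest (m≤m*n (g + Lₖ) (suc (g + L))) z→k (─→-cycle cycle (g + Lₖ))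
    entry : ∀ j → var s k ─[ j ]→ z → (∀ j' → j' < j → ¬ var s k ─[ j' ]→ z) →
            ¬ ¬ (∃[ v ] FirstEntry v c z)
    entry zero    k→z _      = contradiction (subst V (─→-deterministic ─→-refl k→z) (var∈V k)) ¬Vz
    entry (suc j) k→z before with ck , k→ck , ck↦z ← ─→-snoc⁻ k→z =
      pure (k , j , (k→z , before) ,
            subst (var s k ─[ j ]→_)
                  (orbit-predecessor-unique (─→-trans z→k k→ck) ck↦z (─→-trans z→l l→c) c↦z) k→ck)

  hit⇒FirstEntry : V l → FirstHit l (suc L) z → l ─[ L ]→ c₁ → ¬ V z →
                   ¬ ¬ (∃[ v ] FirstEntry v c₁ z)
  hit⇒FirstEntry {l = l} {L = L} {z = z} {c₁ = c} Vl l-hit l→c ¬Vz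
    with u , e , u→l ← V⇒reached Vl = do
      (i , _ , u→z , before) ← ¬¬-least (λ i → var s u ─[ i ]→ z) (─→-trans u→l (proj₁ l-hit))
      entry-of-least i u→z before
    where
    c↦z : fun h c ≡ just z
    c↦z with c' , l→c' , c'↦z ← ─→-snoc⁻ (proj₁ l-hit) =
      subst (λ c → fun h c ≡ just z) (─→-deterministic l→c' l→c) c'↦z
    entry-of-least : ∀ i → var s u ─[ i ]→ z → (∀ j → j < i → ¬ var s u ─[ j ]→ z) →
                     ¬ ¬ (∃[ v ] FirstEntry v c z)
    entry-of-least zero u→z _ = contradiction (subst V (─→-deterministic ─→-refl u→z) (var∈V u)) ¬Vz
    entry-of-least (suc i) u→z before with e ≤? i
    ... | yes e≤i =
      pure (u , i , (u→z , before) , subst (λ k → var s u ─[ k ]→ c) e+L≡i (─→-trans u→l l→c))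
      where
      e+L≡i : e + L ≡ i
      e+L≡i = suc-injective (begin
        suc (e + L)       ≡⟨ +-suc e L ⟨
        e + suc L         ≡⟨ cong (e +_) (FirstHit-unique l-hit
                                (FirstHit-suffix (m≤n⇒m≤1+n e≤i) u→l (u→z , before))) ⟩
        e + (suc i ∸ e)   ≡⟨ m+[n∸m]≡n (m≤n⇒m≤1+n e≤i) ⟩
        suc i             ∎)
    ... | no e≰i = FirstEntry-on-cycle ¬Vz Vl (─→-rest (≰⇒> e≰i) u→z u→l) l→c c↦z

  Clear : LOC → ℕ → Set
  Clear l n = ∀ k y → 1 ≤ k → k ≤ n → hpow h k l ≡ just y → ¬ V y

  clear-hits-agree : ∀ {L₁ L₂} → V l₁ → V l₂ → ¬ V z → ReachesVar z →
    FirstHit l₁ (suc L₁) z → Clear l₁ L₁ → FirstHit l₂ (suc L₂) z → Clear l₂ L₂ → l₁ ≡ l₂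
  clear-hits-agree {z = z} {L₁ = L₁} {L₂ = L₂} Vl₁ Vl₂ ¬Vz z→var hit₁ clear₁ hit₂ clear₂
    with a₁ , l₁→a₁ , a₁↦z ← ─→-snoc⁻ (proj₁ hit₁)
       | a₂ , l₂→a₂ , a₂↦z ← ─→-snoc⁻ (proj₁ hit₂)
    with a₁ ≟ a₂
  -- different predecessors of z are entered by variables that would meet at z;
  -- equal ones let us step back to the predecessor
  ... | no a₁≢a₂ = ⊥-elim ((do
          (_ , entry₁) ← hit⇒FirstEntry Vl₁ hit₁ l₁→a₁ ¬Vz
          (_ , entry₂) ← hit⇒FirstEntry Vl₂ hit₂ l₂→a₂ ¬Vz
          pure (first-entries-agree ¬Vz z→var entry₁ entry₂)) a₁≢a₂)
  ... | yes refl with L₁ | L₂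
  ...   | zero | zero = trans (─→-deterministic ─→-refl l₁→a₁) (─→-deterministic l₂→a₂ ─→-refl)
  ...   | zero | suc L₂' =
          contradiction (subst V (─→-deterministic ─→-refl l₁→a₁) Vl₁)
                        (clear₂ _ _ z<s ≤-refl ⌊ l₂→a₂ ⌋)
  ...   | suc L₁' | zero =
          contradiction (subst V (─→-deterministic ─→-refl l₂→a₂) Vl₂)
                        (clear₁ _ _ z<s ≤-refl ⌊ l₁→a₁ ⌋)
  ...   | suc L₁' | suc L₂' =
          clear-hits-agree Vl₁ Vl₂ (clear₁ _ _ z<s ≤-refl ⌊ l₁→a₁ ⌋)
            (ReachesVar-back (─→-snoc ─→-refl a₁↦z) z→var)
            (step-back hit₁ l₁→a₁) (λ k y 1≤k k≤ → clear₁ k y 1≤k (m≤n⇒m≤1+n k≤))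
            (step-back hit₂ l₂→a₂) (λ k y 1≤k k≤ → clear₂ k y 1≤k (m≤n⇒m≤1+n k≤))
    where
    step-back : ∀ {l L} → FirstHit l (suc L) z → l ─[ L ]→ a₁ → FirstHit l L a₁
    step-back (_ , before) l→a = l→a , λ j j<L l→a' → before (suc j) (s≤s j<L) (─→-snoc l→a' a₁↦z)

  Btw⇒clear-hit : V l → Btw l l' z → ¬ ¬ (∃[ M ] (FirstHit l (suc M) z × Clear l M))
  Btw⇒clear-hit {l = l} {z = z} Vl btw@(L , _ , 1≤L , _ , l→z , _ , clear) = do
    (suc M , M<L , (_ , l→z') , before) ← ¬¬-least (λ k → 1 ≤ k × l ─[ k ]→ z) (1≤L , ⟨ l→z ⟩)
      where (zero , _ , (() , _) , _)
    pure (M , (l→z' , first M before) , λ k y 1≤k k≤M → clear k y 1≤k (≤-trans k≤M (<⇒≤ M<L)))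
    where
    first : ∀ M → (∀ j → j < suc M → ¬ (1 ≤ j × l ─[ j ]→ z)) → ∀ j → j < suc M → ¬ l ─[ j ]→ z
    first M _      zero    _   l→l = Btw⇒¬V btw (subst V (─→-deterministic ─→-refl l→l) Vl)
    first M before (suc j) j<M l→z = before (suc j) j<M (z<s , l→z)

  Btw-source-unique : E l₁ l₁' → Btw l₁ l₁' z → E l₂ l₂' → Btw l₂ l₂' z → l₁ ≡ l₂
  Btw-source-unique {l₁ = l₁} {l₂ = l₂}
                    (Vl₁ , Vl₁' , _) btw₁@(_ , L' , _ , _ , _ , z→l₁' , _) (Vl₂ , _) btw₂ =
    decidable-stable (l₁ ≟ l₂) do
      (_ , hit₁ , clear₁) ← Btw⇒clear-hit Vl₁ btw₁
      (_ , hit₂ , clear₂) ← Btw⇒clear-hit Vl₂ btw₂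
      pure (clear-hits-agree Vl₁ Vl₂ (Btw⇒¬V btw₁) z→var hit₁ clear₁ hit₂ clear₂)
    where
    z→var : ReachesVar _
    z→var = ReachesVar-back {n = L'} ⟨ z→l₁' ⟩ (V⇒ReachesVar Vl₁')

-- Walks

module Walks {T : Set} (R : T → T → Set) where

  -- w 0, …, w (suc k) are the vertices of a walk with k + 1 edges
  Walk : ℕ → T → T → Set
  Walk k t t' = Σ (ℕ → T) λ w → w 0 ≡ t × w (suc k) ≡ t' × ∀ i → i ≤ k → R (w i) (w (suc i))

  private variable
    k : ℕ
    t t' u : T

  walk-edge : R t t' → Walk 0 t t'
  walk-edge {t = t} {t' = t'} t→t' =
    (λ { zero → t ; (suc _) → t' }) , refl , refl , λ { zero _ → t→t' }

  walk-cons : R t u → Walk k u t' → Walk (suc k) t t'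
  walk-cons {t = t} t→u (w , refl , end , steps) =
    (λ { zero → t ; (suc i) → w i }) , refl , end ,
    λ { zero _ → t→u ; (suc i) i<1+k → steps i (s≤s⁻¹ i<1+k) }

  walk-uncons : Walk (suc k) t t' → ∃[ u ] (R t u × Walk k u t')
  walk-uncons (w , refl , end , steps) =
    w 1 , steps 0 z≤n , (λ i → w (suc i)) , refl , end , λ i i≤k → steps (suc i) (s≤s i≤k)

  private
    skip : (a d : ℕ) → ℕ → ℕ
    skip a d i with i ≤? a
    ... | yes _ = i
    ... | no  _ = i + d

    skip-≤ : ∀ {a d i} → i ≤ a → skip a d i ≡ i
    skip-≤ {a} {i = i} i≤a with i ≤? a
    ... | yes _   = refl
    ... | no  i≰a = contradiction i≤a i≰a

    skip-> : ∀ {a d i} → a < i → skip a d i ≡ i + d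
    skip-> {a} {i = i} a<i with i ≤? a
    ... | yes i≤a = contradiction i≤a (<⇒≱ a<i)
    ... | no  _   = refl

  -- positions a < b with w a = w b are bypassed by jumping from a straight to b + 1
  skip-loop : ∀ {a b} ((w , _) : Walk k t t') → 1 ≤ a → a < b → b ≤ suc k → w a ≡ w b →
              Walk (k ∸ (b ∸ a)) t t'
  skip-loop {k = k} {t = t} {t' = t'} {a = a} {b = b}
            (w , start , end , steps) 1≤a a<b b≤1+k wa≡wb =
    (λ i → w (skip a d i)) , start' , end' , steps'
    where
    d = b ∸ a
    a+d≡b : a + d ≡ b
    a+d≡b = m+[n∸m]≡n (<⇒≤ a<b)
    d≤k : d ≤ k
    d≤k = s≤s⁻¹ (≤-trans (+-monoˡ-≤ d 1≤a) (subst (_≤ suc k) (sym a+d≡b) b≤1+k))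
    k'+d≡k : k ∸ d + d ≡ k
    k'+d≡k = m∸n+n≡m d≤k
    start' : w (skip a d 0) ≡ t
    start' = trans (cong w (skip-≤ {a} {d} z≤n)) start
    end' : w (skip a d (suc (k ∸ d))) ≡ t'
    end' = end-by (suc (k ∸ d) ≤? a)
      where
      end-by : Dec (suc (k ∸ d) ≤ a) → w (skip a d (suc (k ∸ d))) ≡ t'
      end-by (no k'≮a) = begin
        w (skip a d (suc (k ∸ d))) ≡⟨ cong w (skip-> {a} {d} (≰⇒> k'≮a)) ⟩
        w (suc (k ∸ d + d))    ≡⟨ cong (w ∘ suc) k'+d≡k ⟩
        w (suc k)              ≡⟨ end ⟩
        t'                     ∎
      end-by (yes k'<a) = begin
        w (skip a d (suc (k ∸ d))) ≡⟨ cong w (skip-≤ {a} {d} k'<a) ⟩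
        w (suc (k ∸ d))        ≡⟨ cong w (≤-antisym k'<a a≤k') ⟩
        w a                    ≡⟨ wa≡wb ⟩
        w b                    ≡⟨ cong w b≡1+k ⟩
        w (suc k)              ≡⟨ end ⟩
        t'                     ∎
        where
        a≤k' : a ≤ suc (k ∸ d)
        a≤k' = +-cancelʳ-≤ d a (suc (k ∸ d))
                 (subst₂ _≤_ (sym a+d≡b) (cong suc (sym k'+d≡k)) b≤1+k)
        b≡1+k : b ≡ suc k
        b≡1+k = begin
          b                 ≡⟨ a+d≡b ⟨
          a + d             ≡⟨ cong (_+ d) (≤-antisym a≤k' k'<a) ⟩
          suc (k ∸ d + d)   ≡⟨ cong suc k'+d≡k ⟩
          suc k             ∎
    i+d≤k : ∀ {i} → i ≤ k ∸ d → i + d ≤ k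
    i+d≤k {i} i≤k' = subst (i + d ≤_) k'+d≡k (+-monoˡ-≤ d i≤k')
    steps' : ∀ i → i ≤ k ∸ d → R (w (skip a d i)) (w (skip a d (suc i)))
    steps' i i≤k' with <-cmp i a
    ... | tri< i<a _ _ = subst₂ R (cong w (sym (skip-≤ {a} {d} (<⇒≤ i<a))))
                                  (cong w (sym (skip-≤ {a} {d} i<a)))
                           (steps i (≤-trans (<⇒≤ i<a) (s≤s⁻¹ (≤-trans a<b b≤1+k))))
    ... | tri≈ _ refl _ = subst₂ R (trans (sym wa≡wb) (cong w (sym (skip-≤ {a} {d} ≤-refl))))
                            (cong w (trans (cong suc (sym a+d≡b)) (sym (skip-> {a} {d} ≤-refl))))
                            (steps b (subst (_≤ k) a+d≡b (i+d≤k i≤k')))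
    ... | tri> _ _ a<i = subst₂ R (cong w (sym (skip-> {a} {d} a<i)))
                                  (cong w (sym (skip-> {a} {d} (m≤n⇒m≤1+n a<i))))
                           (steps (i + d) (i+d≤k i≤k'))

  shorten : ∀ {n} (f : T → Fin n) → Injective _≡_ _≡_ f →
            Walk k t t' → ∃[ k' ] (k' < n × Walk k' t t')
  -- position 0 is left out of the pigeonhole so that a cut never removes every edge
  shorten {k = k} {t = t} {t' = t'} {n = n} f f-inj = <-rec Goal step k
    where
    Goal : ℕ → Set
    Goal k = Walk k t t' → ∃[ k' ] (k' < n × Walk k' t t')
    step : ∀ k → (∀ {k'} → k' < k → Goal k') → Goal k
    step k shorter walk@(w , _) with k <? n
    ... | yes k<n = k , k<n , walk
    ... | no  k≮n with i , j , i<j , same ← pigeonhole (s≤s (≮⇒≥ k≮n)) (λ p → f (w (suc (toℕ p)))) =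
      shorter (∸-monoʳ-< (m<n⇒0<n∸m i<j) (≤-trans (m∸n≤m (toℕ j) (toℕ i)) (s≤s⁻¹ (toℕ<n j))))
              (skip-loop walk (s≤s z≤n) (s≤s i<j) (toℕ<n j) (f-inj same))

-- Formulas

module Terms (q : ℕ) where

  #Terms : ℕ
  #Terms = q + q * q

  toFin : Term q → Fin #Terms
  toFin (x i)   = i ↑ˡ (q * q)
  toFin (m i j) = q ↑ʳ combine i j

  fromFin : Fin #Terms → Term q
  fromFin k = [ x , (λ c → uncurry m (remQuot q c)) ]′ (splitAt q k)

  fromFin-toFin : ∀ t → fromFin (toFin t) ≡ t
  fromFin-toFin (x i)   rewrite splitAt-↑ˡ q i (q * q) = refl
  fromFin-toFin (m i j) rewrite splitAt-↑ʳ q (q * q) (combine i j) =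
    cong (uncurry m) (remQuot-combine i j)

  toFin-injective : ∀ {t t'} → toFin t ≡ toFin t' → t ≡ t'
  toFin-injective {t} {t'} same =
    trans (sym (fromFin-toFin t)) (trans (cong fromFin same) (fromFin-toFin t'))

  terms : List (Term q)
  terms = List.map fromFin (allFin #Terms)

  ∈-terms : ∀ t → t ∈ terms
  ∈-terms t = subst (_∈ terms) (fromFin-toFin t) (∈-map⁺ fromFin (∈-allFin (toFin t)))

module Formulas (q α : ℕ) (1≤α : 1 ≤ α) where
  open Terms q

  Form : Set
  Form = BoolComb (Test q α)

  ⊥F ⊤F : Form
  ⊥F = atom (sizeR 1 ≤-refl 1≤α) ∧' (¬' atom (sizeR 1 ≤-refl 1≤α))
  ⊤F = ¬' ⊥F

  ⋁ : ∀ {A : Set} → List A → (A → Form) → Form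
  ⋁ []       f = ⊥F
  ⋁ (a ∷ as) f = f a ∨' ⋁ as f

  -- test parameters are capped at α to be well typed; the cap is only applied below α
  capped : ∀ k → 1 ≤ suc k ⊓ α × suc k ⊓ α ≤ α
  capped k = ⊓-glb (s≤s z≤n) 1≤α , m⊓n≤n (suc k) α

  capped-id : ∀ {k} → suc k ≤ α → suc k ⊓ α ≡ suc k
  capped-id = m≤n⇒m⊓n≡m

  module Semantics (σ : Store × Heap) where

    ⊨_ : Form → Set
    ⊨ φ = ⟦ φ ⟧B σ

    ⊤F-holds : ⊨ ⊤F
    ⊤F-holds (a , ¬a) = ¬a a

    ⋁⁺ : ∀ {A : Set} {as : List A} {f : A → Form} {a} → a ∈ as → ⊨ f a → ⊨ ⋁ as f
    ⋁⁺ (here refl) fa = inj₁ fa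
    ⋁⁺ (there a∈as) fa = inj₂ (⋁⁺ a∈as fa)

    ⋁⁻ : ∀ {A : Set} (as : List A) (f : A → Form) → ⊨ ⋁ as f → ∃[ a ] (a ∈ as × ⊨ f a)
    ⋁⁻ []       f (a , ¬a)  = contradiction a ¬a
    ⋁⁻ (a ∷ as) f (inj₁ fa) = a , here refl , fa
    ⋁⁻ (a ∷ as) f (inj₂ φ)  = Product.map₂ (Product.map₁ there) (⋁⁻ as f φ)

  RemF : ℕ → Form
  RemF zero    = ⊤F
  RemF (suc k) = atom (sizeR (suc k ⊓ α) (proj₁ (capped k)) (proj₂ (capped k)))

  sees≥ : Term q → ℕ → Term q → Form
  sees≥ t k t' = atom (sees t t' (suc k ⊓ α) (proj₁ (capped k)) (proj₂ (capped k)))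

  SeesF : Term q → ℕ → Form
  SeesF t zero    = ⊤F
  SeesF t (suc k) = ⋁ terms (sees≥ t k)

  OwnsF : List (Term q) → Term q → ℕ → Form
  OwnsF ps t zero    = ⊤F
  OwnsF ps t (suc c) = (¬' ⋁ ps (λ p → atom (eq p t))) ∧' (atom (alloc t) ∧' SeesF t c)

  -- an allocated location is counted in Rem or in the segment of the first term of the list
  -- that labels the segment's source; ps are the terms already passed
  CountF : List (Term q) → List (Term q) → ℕ → Form
  CountF []       ps k = RemF k
  CountF (t ∷ ts) ps k = ⋁ (upTo (suc k)) λ c → OwnsF ps t c ∧' CountF ts (t ∷ ps) (k ∸ c)

  SizeF : ℕ → Form
  SizeF β = ¬' (¬' CountF terms [] β)

  module SizeSemantics (s : Store) (h : Heap) where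
    open Semantics (s , h)
    open Iteration h
    open SupportGraph {q} s h

    Segment : LOC → Pred LOC 0ℓ
    Segment l z = (l ≡ z × InDom h l) ⊎ ∃[ l' ] (E l l' × Btw l l' z)

    Fresh : List (Term q) → Term q → Set
    Fresh ps t = ∀ p → p ∈ ps → ¬ ⊨ atom (eq p t)

    OwnedBy : List (Term q) → Term q → Pred LOC 0ℓ
    OwnedBy ps t z = Fresh ps t × ∃[ l ] (Lab l t × Segment l z)

    Covered : List (Term q) → List (Term q) → Pred LOC 0ℓ
    Covered []       ps = Rem
    Covered (t ∷ ts) ps = OwnedBy ps t ∪ Covered ts (t ∷ ps)

    Segment⇒source-inDom : ∀ {l z} → Segment l z → InDom h l
    Segment⇒source-inDom (inj₁ (_ , l∈dom))  = l∈dom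
    Segment⇒source-inDom (inj₂ (_ , _ , btw)) = Btw⇒source-inDom btw

    Segment⇒inDom : ∀ {l z} → Segment l z → InDom h z
    Segment⇒inDom (inj₁ (refl , l∈dom)) = l∈dom
    Segment⇒inDom (inj₂ (_ , _ , btw))  = Btw⇒inDom btw

    Segment-source-unique : ∀ {l₁ l₂ z} → V l₁ → V l₂ → Segment l₁ z → Segment l₂ z → l₁ ≡ l₂
    Segment-source-unique _   _   (inj₁ (refl , _)) (inj₁ (refl , _))   = refl
    Segment-source-unique Vl₁ _ (inj₁ (refl , _)) (inj₂ (_ , _ , btw)) =
      contradiction Vl₁ (Btw⇒¬V btw)
    Segment-source-unique _ Vl₂ (inj₂ (_ , _ , btw)) (inj₁ (refl , _)) =
      contradiction Vl₂ (Btw⇒¬V btw)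
    Segment-source-unique _   _   (inj₂ (_ , E₁ , btw₁)) (inj₂ (_ , E₂ , btw₂)) =
      Btw-source-unique E₁ btw₁ E₂ btw₂

    Segment-edge : ∀ {l l'} → E l l' → Segment l ⊆ ｛ l ｝ ∪ Btw l l'
    Segment-edge _  (inj₁ (refl , _))        = inj₁ refl
    Segment-edge El (inj₂ (_ , El'' , btw)) with refl ← E-functional El El'' = inj₂ btw

    Fresh⁺ : ∀ {ps t} → Fresh ps t → ⊨ (¬' ⋁ ps (λ p → atom (eq p t)))
    Fresh⁺ {ps} {t} fresh shared with p , p∈ps , same ← ⋁⁻ ps (λ p → atom (eq p t)) shared =
      fresh p p∈ps same

    Fresh⁻ : ∀ {ps t} → ⊨ (¬' ⋁ ps (λ p → atom (eq p t))) → Fresh ps t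
    Fresh⁻ ¬shared p p∈ps same = ¬shared (⋁⁺ p∈ps same)

    RemF⁻ : ∀ {k} → k ≤ α → ⊨ RemF k → AtLeast k Rem
    RemF⁻ {zero}  _   _   = AtLeast-0 {P = Rem}
    RemF⁻ {suc k} k<α rem = subst (λ n → AtLeast n Rem) (capped-id k<α) rem

    RemF⁺ : ∀ {k} → k ≤ α → AtLeast k Rem → ⊨ RemF k
    RemF⁺ {zero}  _   _   = ⊤F-holds
    RemF⁺ {suc k} k<α rem = subst (λ n → AtLeast n Rem) (sym (capped-id k<α)) rem

    OwnsF⁻ : ∀ {ps t} c → c ≤ α → ⊨ OwnsF ps t c → AtLeast c (OwnedBy ps t)
    OwnsF⁻ {ps} {t} zero    _   _ = AtLeast-0 {P = OwnedBy ps t}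
    OwnsF⁻ {ps} {t} (suc c) c<α (¬shared , (l , (_ , l∈dom) , lab) , far) = segment c c<α far
      where
      fresh : Fresh ps t
      fresh = Fresh⁻ ¬shared
      segment : ∀ c → suc c ≤ α → ⊨ SeesF t c → AtLeast (suc c) (OwnedBy ps t)
      segment zero _ _ = AtLeast-1 {P = OwnedBy ps t} (fresh , l , lab , inj₁ (refl , l∈dom))
      segment (suc c) c<α far
        with _ , _ , l₀ , l' , El , lab₀ , _ , between ← ⋁⁻ terms (sees≥ t c) far
        with refl ← Lab-functional lab₀ lab
        = AtLeast-mono {P = ｛ l ｝ ∪ Btw l l'} {Q = OwnedBy ps t}
            (λ { (inj₁ refl) → fresh , l , lab , inj₁ (refl , l∈dom)
               ; (inj₂ btw)  → fresh , l , lab , inj₂ (l' , El , btw) })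
            (AtLeast-∪ {P = ｛ l ｝} {Q = Btw l l'} (λ { refl btw → Btw⇒¬V btw (t , lab) })
               (AtLeast-1 {P = ｛ l ｝} refl)
               (subst (λ n → AtLeast n (Btw l l')) (capped-id (≤-trans (n≤1+n _) c<α)) between))

    owned-edge : ∀ {ps t l} → Lab l t → AtLeast 2 (OwnedBy ps t) → ∃[ l' ] (E l l')
    owned-edge {ps} {t} {l} lab owned
      with z₁ , (_ , l₁ , lab₁ , seg₁) , rest ← AtLeast-uncons {P = OwnedBy ps t} owned
      with z₂ , ((_ , l₂ , lab₂ , seg₂) , z₁≢z₂) , _
             ← AtLeast-uncons {P = OwnedBy ps t ∖ ｛ z₁ ｝} rest
      with refl ← Lab-functional lab₁ lab | refl ← Lab-functional lab₂ lab
      with seg₁ | seg₂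
    ... | inj₂ (l' , El , _) | _                  = l' , El
    ... | inj₁ _             | inj₂ (l' , El , _) = l' , El
    ... | inj₁ (refl , _)    | inj₁ (refl , _)    = contradiction refl z₁≢z₂

    owned⊆edge : ∀ {ps t l l'} → E l l' → Lab l t → OwnedBy ps t ⊆ ｛ l ｝ ∪ Btw l l'
    owned⊆edge El lab (_ , _ , lab' , seg) with refl ← Lab-functional lab' lab = Segment-edge El seg

    OwnsF⁺ : ∀ {ps t} c → c ≤ α → AtLeast c (OwnedBy ps t) → ⊨ OwnsF ps t c
    OwnsF⁺ zero _ _ = ⊤F-holds
    OwnsF⁺ {ps} {t} (suc c) c<α owned
      with _ , (fresh , l , lab , seg) , _ ← AtLeast-uncons {P = OwnedBy ps t} owned
      = Fresh⁺ fresh , (l , ((t , lab) , Segment⇒source-inDom seg) , lab) , sees-rest c c<α owned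
      where
      sees-rest : ∀ c → suc c ≤ α → AtLeast (suc c) (OwnedBy ps t) → ⊨ SeesF t c
      sees-rest zero    _   _     = ⊤F-holds
      sees-rest (suc c) c<α owned
        with l' , El ← owned-edge lab (AtLeast-weaken {P = OwnedBy ps t} (s≤s (s≤s z≤n)) owned)
        with c₁ , c₁≤ , at-l , at-btw
               ← AtLeast-∪⁻ {P = ｛ l ｝} {Q = Btw l l'} (suc (suc c))
                   (AtLeast-mono {P = OwnedBy ps t} (owned⊆edge El lab) owned)
        = ⋁⁺ (∈-terms t') (l , l' , El , lab , lab' ,
             subst (λ n → AtLeast n (Btw l l')) (sym (capped-id (≤-trans (n≤1+n _) c<α)))
               (AtLeast-weaken {P = Btw l l'} enough at-btw))
        where
        t' = proj₁ (proj₁ (proj₂ El))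
        lab' = proj₂ (proj₁ (proj₂ El))
        enough : suc c ≤ suc (suc c) ∸ c₁
        enough = ≤-trans (≤-reflexive (sym (m+n∸m≡n 1 (suc c))))
                         (∸-monoʳ-≤ (suc (suc c))
                           (AtLeast-subsingleton {P = ｛ l ｝} (λ refl → refl) at-l))

    owned-uncovered : ∀ ts {ps ps' t z} → t ∈ ps' → OwnedBy ps t z → ¬ Covered ts ps' z
    owned-uncovered [] _ (_ , l , lab , inj₁ (refl , l∈dom)) (_ , ¬A , _) = ¬A ((_ , lab) , l∈dom)
    owned-uncovered [] _ (_ , l , lab , inj₂ (l' , El , btw)) (_ , _ , ¬btw) =
      ¬btw (l , l' , El , btw)
    owned-uncovered (u ∷ ts) {t = t} t∈ps' (_ , l , lab , seg) (inj₁ (fresh , l' , lab' , seg'))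
      with refl ← Segment-source-unique (u , lab') (t , lab) seg' seg
      = fresh t t∈ps' (l , (t , lab) , lab , lab')
    owned-uncovered (u ∷ ts) t∈ps' owned (inj₂ covered) =
      owned-uncovered ts (there t∈ps') owned covered

    Covered⇒InDom : ∀ ts {ps} → Covered ts ps ⊆ InDom h
    Covered⇒InDom []       (z∈dom , _)                  = z∈dom
    Covered⇒InDom (t ∷ ts) (inj₁ (_ , _ , _ , seg)) = Segment⇒inDom seg
    Covered⇒InDom (t ∷ ts) (inj₂ covered)             = Covered⇒InDom ts covered

    CountF⁻ : ∀ ts {ps k} → k ≤ α → ⊨ CountF ts ps k → AtLeast k (Covered ts ps)
    CountF⁻ []                   k≤α counted = RemF⁻ k≤α counted
    CountF⁻ (t ∷ ts) {ps} {k} k≤α counted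
      with c , c∈ , owns , rest
             ← ⋁⁻ (upTo (suc k)) (λ c → OwnsF ps t c ∧' CountF ts (t ∷ ps) (k ∸ c)) counted
      = subst (λ n → AtLeast n (Covered (t ∷ ts) ps)) (m+[n∸m]≡n c≤k)
          (AtLeast-∪ {P = OwnedBy ps t} {Q = Covered ts (t ∷ ps)} (owned-uncovered ts (here refl))
            (OwnsF⁻ c (≤-trans c≤k k≤α) owns) (CountF⁻ ts (≤-trans (m∸n≤m k c) k≤α) rest))
      where c≤k = s≤s⁻¹ (∈-upTo⁻ c∈)

    CountF⁺ : ∀ ts {ps k} → k ≤ α → AtLeast k (Covered ts ps) → ⊨ CountF ts ps k
    CountF⁺ []                   k≤α covered = RemF⁺ k≤α covered
    CountF⁺ (t ∷ ts) {ps} {k} k≤α covered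
      with c , c≤k , owned , rest
             ← AtLeast-∪⁻ {P = OwnedBy ps t} {Q = Covered ts (t ∷ ps)} k covered
      = ⋁⁺ (∈-upTo⁺ (s≤s c≤k))
           (OwnsF⁺ c (≤-trans c≤k k≤α) owned , CountF⁺ ts (≤-trans (m∸n≤m k c) k≤α) rest)

    segment-covered : ∀ ts {ps t l z} → Segment l z → Lab l t → t ∈ ts →
                      (∀ p → p ∈ ps → ¬ Lab l p) → ¬ ¬ Covered ts ps z
    segment-covered (u ∷ ts) {ps} {t} {l} seg lab t∈ts unlabelled = do
      no ¬lab-u ← ¬¬-excluded-middle {A = Lab l u}
        where yes lab-u → pure (inj₁ (fresh lab-u , l , lab-u , seg))
      covered ← segment-covered ts seg lab (later ¬lab-u t∈ts) (extend ¬lab-u)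
      pure (inj₂ covered)
      where
      fresh : Lab l u → Fresh ps u
      fresh lab-u p p∈ps (l' , _ , lab-p , lab-u')
        with refl ← Lab-functional lab-u' lab-u = unlabelled p p∈ps lab-p
      later : ¬ Lab l u → t ∈ u ∷ ts → t ∈ ts
      later ¬lab-u (here refl) = contradiction lab ¬lab-u
      later _      (there t∈ts) = t∈ts
      extend : ¬ Lab l u → ∀ p → p ∈ u ∷ ps → ¬ Lab l p
      extend ¬lab-u p (here refl)  = ¬lab-u
      extend _      p (there p∈ps) = unlabelled p p∈ps

    InDom⇒¬¬Covered : ∀ {z} → InDom h z → ¬ ¬ Covered terms [] z
    InDom⇒¬¬Covered {z} z∈dom = do
      no ¬Vz ← ¬¬-excluded-middle {A = V z}
        where yes (t , lab) → segment-covered terms (inj₁ (refl , z∈dom)) lab (∈-terms t) (λ _ ())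
      no ¬btw ← ¬¬-excluded-middle {A = ∃[ l ] ∃[ l' ] (E l l' × Btw l l' z)}
        where yes (l , l' , El@((t , lab) , _) , btw) →
                segment-covered terms (inj₂ (l' , El , btw)) lab (∈-terms t) (λ _ ())
      pure (rem-covered terms (z∈dom , (λ A → ¬Vz (proj₁ A)) , ¬btw))
      where
      rem-covered : ∀ ts {ps} → Rem z → Covered ts ps z
      rem-covered []       rem = rem
      rem-covered (_ ∷ ts) rem = inj₂ (rem-covered ts rem)

    SizeF-sound : ∀ {β} → β ≤ α → AtLeast β (InDom h) → ⊨ SizeF β
    SizeF-sound β≤α dom ¬count = (do
      covered ← AtLeast-¬¬ {P = InDom h} {Q = Covered terms []} InDom⇒¬¬Covered dom
      pure (CountF⁺ terms β≤α covered)) ¬count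

    SizeF-complete : ∀ {β} → β ≤ α → ⊨ SizeF β → AtLeast β (InDom h)
    SizeF-complete {β} β≤α ¬¬count = decidable-stable (AtLeast-InDom? β) λ ¬dom →
      ¬¬count λ count →
        ¬dom (AtLeast-mono {P = Covered terms []} (Covered⇒InDom terms) (CountF⁻ terms β≤α count))

  EdgeF : Term q → Term q → Form
  EdgeF t t' = atom (pts t t') ∨' atom (sees t t' 1 ≤-refl 1≤α)

  PathF : ℕ → Term q → Term q → Form
  PathF zero    t t' = EdgeF t t'
  PathF (suc k) t t' = ⋁ terms λ u → EdgeF t u ∧' PathF k u t'

  ReachF : Fin q → Fin q → Form
  ReachF i j = ¬' (¬' ⋁ (upTo #Terms) λ k → PathF k (x i) (x j))

  module ReachSemantics (s : Store) (h : Heap) where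
    open Semantics (s , h)
    open Iteration h
    open SupportGraph {q} s h

    Edge : Term q → Term q → Set
    Edge t t' = ∃[ l ] ∃[ l' ] (E l l' × Lab l t × Lab l' t')

    open Walks Edge

    EdgeF⁻ : ∀ {t t'} → ⊨ EdgeF t t' → Edge t t'
    EdgeF⁻ (inj₁ (l , l' , El , lab , lab' , _)) = l , l' , El , lab , lab'
    EdgeF⁻ (inj₂ (l , l' , El , lab , lab' , _)) = l , l' , El , lab , lab'

    EdgeF⁺ : ∀ {t t'} → Edge t t' → ¬ ¬ ⊨ EdgeF t t'
    EdgeF⁺ {t} {t'} (l , l' , El , lab , lab') = do
      no nothing-between ← ¬¬-excluded-middle {A = ∃[ z ] Btw l l' z}
        where yes (z , btw) → pure (inj₂ (l , l' , El , lab , lab' , AtLeast-1 {P = Btw l l'} btw))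
      pure (inj₁ (l , l' , El , lab , lab' , λ z btw → nothing-between (z , btw)))

    PathF⁻ : ∀ k {t t'} → ⊨ PathF k t t' → Walk k t t'
    PathF⁻ zero    edge = walk-edge (EdgeF⁻ edge)
    PathF⁻ (suc k) {t} {t'} path
      with u , _ , edge , rest ← ⋁⁻ terms (λ u → EdgeF t u ∧' PathF k u t') path
      = walk-cons (EdgeF⁻ edge) (PathF⁻ k rest)

    PathF⁺ : ∀ k {t t'} → Walk k t t' → ¬ ¬ ⊨ PathF k t t'
    PathF⁺ zero    (w , refl , refl , steps) = EdgeF⁺ (steps 0 z≤n)
    PathF⁺ (suc k) walk with u , edge , rest ← walk-uncons walk = do
      edgeF ← EdgeF⁺ edge
      pathF ← PathF⁺ k rest
      pure (⋁⁺ (∈-terms u) (edgeF , pathF))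

    walk⇒Reach⁺ : ∀ k {t t'} → Walk k t t' → ∃[ l ] ∃[ l' ] (Lab l t × Lab l' t' × Reach⁺ l l')
    walk⇒Reach⁺ zero (w , refl , refl , steps)
      with l , l' , (_ , _ , L , 1≤L , l→l' , _) , lab , lab' ← steps 0 z≤n
      = l , l' , lab , lab' , L , 1≤L , ⟨ l→l' ⟩
    walk⇒Reach⁺ (suc k) walk
      with u , (l , l₁ , (_ , _ , L , 1≤L , l→l₁ , _) , lab , lab₁) , rest ← walk-uncons walk
      with l₂ , l' , lab₂ , lab' , n , 1≤n , l₂→l' ← walk⇒Reach⁺ k rest
      with refl ← Lab-functional lab₁ lab₂
      = l , l' , lab , lab' , L + n , ≤-trans 1≤L (m≤m+n L n) , ─→-trans ⟨ l→l₁ ⟩ l₂→l'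

    reach⇒walk : ∀ {j} n {t l} → Lab l t → l ─[ suc n ]→ var s j → ¬ ¬ (∃[ k ] Walk k t (x j))
    reach⇒walk {j} = <-rec Goal step
      where
      Goal : ℕ → Set
      Goal n = ∀ {t l} → Lab l t → l ─[ suc n ]→ var s j → ¬ ¬ (∃[ k ] Walk k t (x j))
      NextLabelled : LOC → Pred ℕ 0ℓ
      NextLabelled l L = 1 ≤ L × ∃[ y ] (l ─[ L ]→ y × V y)
      step : ∀ n → (∀ {n'} → n' < n → Goal n') → Goal n
      step n shorter {t} {l} lab l→j = do
        (suc L , L<1+n , (_ , y , l→y , Vy@(t' , lab')) , earlier)
            ← ¬¬-least (NextLabelled l) (z<s , var s j , l→j , var∈V j)
          where (zero , _ , (() , _) , _)
        let El : E l y
            El = (t , lab) , Vy , suc L , z<s , ⌊ l→y ⌋ ,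
                 λ L' z 1≤L' L'<1+L l→z Vz → earlier L' L'<1+L (1≤L' , z , ⟨ l→z ⟩ , Vz)
        yes refl ← pure (L ≟ n)
          where no L≢n → do
                  let L<n = ≤∧≢⇒< (s≤s⁻¹ L<1+n) L≢n
                      y→j : y ─[ suc (n ∸ suc L) ]→ var s j
                      y→j = subst (λ k → y ─[ k ]→ var s j) (+-∸-assoc 1 L<n)
                              (─→-rest L<1+n l→y l→j)
                  (k , walk) ← shorter (∸-monoʳ-< z<s L<n) lab' y→j
                  pure (suc k , walk-cons (l , y , El , lab , lab') walk)
        pure (0 , walk-edge (l , y , El , lab , ─→-deterministic l→y l→j))

    reach⁺⇒ReachF : ∀ {i j} → (s , h) ⊨reach⁺ toℕ i , toℕ j → ⊨ ReachF i j
    reach⁺⇒ReachF {i} {j} (suc n , _ , i→j) no-path = (do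
      (k , walk) ← reach⇒walk n refl ⟨ i→j ⟩
      let (k' , k'<#Terms , walk') = shorten toFin toFin-injective walk
      path ← PathF⁺ k' walk'
      pure (⋁⁺ (∈-upTo⁺ k'<#Terms) path)) no-path

    ReachF⇒reach⁺ : ∀ {i j} → ⊨ ReachF i j → (s , h) ⊨reach⁺ toℕ i , toℕ j
    ReachF⇒reach⁺ {i} {j} ¬¬path =
      Product.map₂ (Product.map₂ ⌊_⌋) (decidable-stable (Reach⁺? _ _) ¬¬reach)
      where
      path⇒Reach⁺ : ∃[ k ] (k ∈ upTo #Terms × ⊨ PathF k (x i) (x j)) → Reach⁺ (var s i) (var s j)
      path⇒Reach⁺ (k , _ , path)
        with _ , _ , refl , refl , reach ← walk⇒Reach⁺ k (PathF⁻ k path) = reach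
      ¬¬reach : ¬ ¬ Reach⁺ (var s i) (var s j)
      ¬¬reach ¬reach = ¬¬path λ paths →
        ¬reach (path⇒Reach⁺ (⋁⁻ (upTo #Terms) (λ k → PathF k (x i) (x j)) paths))

emp⇔¬size≥1 : ∀ σ → σ ⊨emp ⇔ (¬ σ ⊨size≥ 1)
emp⇔¬size≥1 (s , h) =
  mk⇔ (λ emp (f , _ , f∈dom) → emp (f fzero) (f∈dom fzero))
      (λ ¬size l l∈dom → ¬size (AtLeast-1 {P = InDom h} l∈dom))

lemma4p5 : (α q : ℕ) → 1 ≤ α → 1 ≤ q → (i j : Fin q) →
    EquivBC q α (λ σ → σ ⊨reach⁺ toℕ i , toℕ j)
    × EquivBC q α (λ σ → σ ⊨emp)
    × ((β : ℕ) → β ≤ α → EquivBC q α (λ σ → σ ⊨size≥ β))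
lemma4p5 α q 1≤α _ i j = reach , emp , size
  where
  open Formulas q α 1≤α
  reach : EquivBC q α (λ σ → σ ⊨reach⁺ toℕ i , toℕ j)
  reach = ReachF i j , λ (s , h) → let open ReachSemantics s h in
    mk⇔ reach⁺⇒ReachF ReachF⇒reach⁺
  size : (β : ℕ) → β ≤ α → EquivBC q α (λ σ → σ ⊨size≥ β)
  size β β≤α = SizeF β , λ (s , h) → let open SizeSemantics s h in
    mk⇔ (SizeF-sound β≤α) (SizeF-complete β≤α)
  emp : EquivBC q α (λ σ → σ ⊨emp)
  emp = ¬' SizeF 1 , λ σ@(s , h) → let open SizeSemantics s h in
    mk⇔ (λ empty size≥1 → Equivalence.to (emp⇔¬size≥1 σ) empty (SizeF-complete 1≤α size≥1))
        (λ ¬size≥1 → Equivalence.from (emp⇔¬size≥1 σ) (¬size≥1 ∘ SizeF-sound 1≤α))
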